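{- Let $d$ be a constant and $f:\mathbb{F}_2^d\to\mathbb{F}_2$ with $\mathrm{pdeg}(f)=p<d$. Define $f^1=f$ and $f^{i+1}(x_1,\dots,x_{d^{i+1}})=f\big(f^i(x_1,\dots,x_{d^i}),\dots,f^i(x_{(d-1)d^i+1},\dots,x_{d^{i+1}})\big)$. For $u\ge1$ let $n=d^u$ and $g^u=f^u\oplus x_1\oplus\cdots\oplus x_n$. Then $g^u$ is $\big(n-n^{\frac{\log p}{\log d}}-1\big)$-resilient and there is a Boolean circuit computing $g^u$ of size $O(n)$ and depth $O(\log n)$.
   Context: $\mathrm{pdeg}$ is the real polynomial degree (degree of the unique multilinear real polynomial agreeing with the function on the Boolean cube). The Walsh transform is $W_h(\mathbf{u})=\sum_{\mathbf{x}}(-1)^{h(\mathbf{x})\oplus\mathbf{u}\cdot\mathbf{x}}$; $h$ is $m$-resilient if $W_h(\mathbf{u})=0$ for all $\mathbf{u}$ of Hamming weight at most $m$. -}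

module Defs where

open import Data.Bool using (Bool; true; false; _xor_; _∧_; _∨_; not; if_then_else_)
open import Data.Nat using (ℕ; zero; suc; _+_; _*_; _∸_; _^_; _≤_; _<_; _⊔_)
open import Data.Fin using (Fin)
open import Data.Vec using (Vec; []; _∷_; take; drop; map; lookup; foldr; zipWith; head)
open import Data.List using (List; []; _∷_; _++_)
import Data.List as List
open import Data.Integer using (ℤ; +_; -[1+_])
import Data.Integer as ℤ
open import Data.Rational using (ℚ; 0ℚ; 1ℚ)
import Data.Rational as ℚ
open import Data.Product using (Σ; _×_; _,_)
open import Data.Sum using (_⊎_)
open import Relation.Binary.PropositionalEquality using (_≡_)
open import Relation.Nullary using (¬_)

allVecs : (n : ℕ) → List (Vec Bool n)
allVecs zero    = [] ∷ []
allVecs (suc n) = List.map (false ∷_) (allVecs n) ++ List.map (true ∷_) (allVecs n)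

weight : ∀ {n} → Vec Bool n → ℕ
weight []           = 0
weight (true  ∷ xs) = suc (weight xs)
weight (false ∷ xs) = weight xs

parity : ∀ {n} → Vec Bool n → Bool
parity = foldr _ _xor_ false

dot : ∀ {n} → Vec Bool n → Vec Bool n → Bool
dot u x = parity (zipWith _∧_ u x)

b2q : Bool → ℚ
b2q true  = 1ℚ
b2q false = 0ℚ

monomial : ∀ {n} → Vec Bool n → Vec Bool n → ℚ
monomial []           []       = 1ℚ
monomial (true  ∷ S) (x ∷ xs) = b2q x ℚ.* monomial S xs
monomial (false ∷ S) (x ∷ xs) = monomial S xs

sumℚ : List ℚ → ℚ
sumℚ = List.foldr ℚ._+_ 0ℚ

polyEval : ∀ {n} → (Vec Bool n → ℚ) → Vec Bool n → ℚ
polyEval {n} c x = sumℚ (List.map (λ S → c S ℚ.* monomial S x) (allVecs n))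

-- PDeg h p : the multilinear polynomial agreeing with h on the cube has
-- degree exactly p (degree of the zero polynomial taken to be 0).
PDeg : ∀ {n} → (Vec Bool n → Bool) → ℕ → Set
PDeg {n} h p =
  Σ (Vec Bool n → ℚ) λ c →
    (∀ x → polyEval c x ≡ b2q (h x)) ×
    (∀ S → p < weight S → c S ≡ 0ℚ) ×
    (p ≡ 0 ⊎ Σ (Vec Bool n) λ S → weight S ≡ p × ¬ (c S ≡ 0ℚ))

sign : Bool → ℤ
sign false = + 1
sign true  = -[1+ 0 ]

sumℤ : List ℤ → ℤ
sumℤ = List.foldr ℤ._+_ (+ 0)

walsh : ∀ {n} → (Vec Bool n → Bool) → Vec Bool n → ℤ
walsh {n} h u = sumℤ (List.map (λ x → sign (h x xor dot u x)) (allVecs n))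

Resilient : ∀ {n} → (Vec Bool n → Bool) → ℕ → Set
Resilient {n} h m = ∀ (u : Vec Bool n) → weight u ≤ m → walsh h u ≡ + 0

chop : ∀ {A : Set} (d k : ℕ) → Vec A (d * k) → Vec (Vec A k) d
chop zero    k xs = []
chop (suc d) k xs = take k xs ∷ chop d k (drop k xs)

-- fIter f i : F_2^(d^i) → F_2 ; fIter f 0 is the identity on one bit,
-- so fIter f 1 x = f x (up to the canonical identification d*1 = d), and
-- fIter f (i+1) x = f (fIter f i (block 1), ..., fIter f i (block d)).
fIter : ∀ {d} → (Vec Bool d → Bool) → (i : ℕ) → Vec Bool (d ^ i) → Bool
fIter f zero    x = head x
fIter {d} f (suc i) x = f (map (fIter f i) (chop d (d ^ i) x))

gIter : ∀ {d} → (Vec Bool d → Bool) → (u : ℕ) → Vec Bool (d ^ u) → Bool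
gIter f u x = fIter f u x xor parity x

-- A circuit with n inputs and k wires: the first n
-- wires are inputs, every further wire is a gate reading earlier wires.

data Gate (k : ℕ) : Set where
  const : Bool → Gate k
  NOT   : Fin k → Gate k
  AND   : Fin k → Fin k → Gate k
  OR    : Fin k → Fin k → Gate k

data Circ (n : ℕ) : ℕ → Set where
  inputs : Circ n n
  _▷_    : ∀ {k} → Circ n k → Gate k → Circ n (suc k)

evalGate : ∀ {k} → Gate k → Vec Bool k → Bool
evalGate (const b) w = b
evalGate (NOT i)   w = not (lookup w i)
evalGate (AND i j) w = lookup w i ∧ lookup w j
evalGate (OR i j)  w = lookup w i ∨ lookup w j

-- values on all wires (most recent gate first)
wires : ∀ {n k} → Circ n k → Vec Bool n → Vec Bool k
wires inputs    x = x
wires (c ▷ g) x = evalGate g (wires c x) ∷ wires c x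

gateDepth : ∀ {k} → Gate k → Vec ℕ k → ℕ
gateDepth (const b) ds = 0
gateDepth (NOT i)   ds = suc (lookup ds i)
gateDepth (AND i j) ds = suc (lookup ds i ⊔ lookup ds j)
gateDepth (OR i j)  ds = suc (lookup ds i ⊔ lookup ds j)

depths : ∀ {n k} → Circ n k → Vec ℕ k
depths {n} inputs = Data.Vec.replicate n 0
depths (c ▷ g)   = gateDepth g (depths c) ∷ depths c

gates : ∀ {n k} → Circ n k → ℕ
gates inputs  = 0
gates (c ▷ g) = suc (gates c)

record Circuit (n : ℕ) : Set where
  constructor circuit
  field
    wireCount : ℕ
    body      : Circ n wireCount
    output    : Fin wireCount

open Circuit public

run : ∀ {n} → Circuit n → Vec Bool n → Bool
run C x = lookup (wires (body C) x) (output C)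

size : ∀ {n} → Circuit n → ℕ
size C = gates (body C)

depth : ∀ {n} → Circuit n → ℕ
depth C = lookup (depths (body C)) (output C)

Computes : ∀ {n} → Circuit n → (Vec Bool n → Bool) → Set
Computes C h = ∀ x → run C x ≡ h x

-- f^u has Fourier degree at most p^u: over ℚ, the functions whose Fourier coefficients vanish above
-- weight D are closed under sums and scalars, and on disjoint blocks of variables the degrees of a
-- product add, so substituting functions of degree q into a polynomial of degree p gives degree p·q.
-- Adding the parity moves the Walsh coefficient of g^u at w to the Fourier coefficient of (-1)^(f^u)
-- at the complement of w, whose weight exceeds p^u as soon as wt(w) ≤ n - p^u - 1.
-- For the circuits, every m-ary function has a Shannon-expansion circuit with 2^O(m) gates and depth
-- 3m; wiring copies of the ones for f and for the d-ary parity into d-ary trees of height u costs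
-- O(d^u) gates and depth O(u) = O(log n), and one more constant-size circuit XORs the two outputs.

module Submission where

open import Algebra.Bundles using (CommutativeRing)
open import Data.Bool using (Bool; true; false; _xor_; _∧_; _∨_; not; if_then_else_)
open import Data.Bool.Properties using (xor-assoc; xor-identityʳ; ∨-identityʳ; xor-∧-commutativeRing)
open import Algebra.Properties.CommutativeSemigroup
  (CommutativeRing.+-commutativeSemigroup xor-∧-commutativeRing) using (interchange)
open import Data.Fin using (Fin; zero; suc)
open import Data.Integer using (ℤ; +_; ∣_∣)
import Data.Integer as ℤ
import Data.Integer.Properties as ℤ
open import Data.List using (List; []; _∷_)
import Data.List as List
import Data.List.Properties as List
open import Data.Nat using (ℕ; zero; suc; _+_; _*_; _∸_; _^_; _≤_; _<_; z≤n; s≤s)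
import Data.Nat.Coprimality as Coprime
open import Data.Nat.Logarithm using (⌊log₂_⌋; ⌊log₂⌋-mono-≤; ⌊log₂[2^n]⌋≡n)
open import Data.Nat.Properties
import Data.Nat.Solver
open import Data.Product using (Σ; _×_; _,_)
import Data.Product as Product
open import Data.Rational using (ℚ; mkℚ; ↥_; 0ℚ; 1ℚ; -_) renaming (_+_ to _+ℚ_; _*_ to _*ℚ_)
import Data.Rational.Properties as ℚ
open import Data.Rational.Solver using (module +-*-Solver)
open import Data.Rational.Unnormalised using (*≡*)
import Data.Rational.Unnormalised.Properties as ℚᵘ
open import Data.Sum using (_⊎_; inj₁; inj₂)
open import Data.Vec using (Vec; []; _∷_; _++_; take; drop; map; lookup; tabulate)
open import Data.Vec.Properties
  using (map-cong; take++drop≡id; take-map; drop-map; tabulate-∘; tabulate∘lookup; lookup∘tabulate;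
         lookup-replicate)
open import Data.Vec.Relation.Unary.All using (All; []; _∷_)
import Data.Vec.Relation.Unary.All as All
import Data.Vec.Relation.Unary.All.Properties as All
open import Function using (_∘_)
open import Relation.Binary.PropositionalEquality
open import Relation.Nullary using (yes; no; contradiction)

open import Defs

toℚ : ℤ → ℚ
toℚ z = mkℚ z 0 (Coprime.sym (Coprime.1-coprimeTo ∣ z ∣))

toℚ-+ : ∀ a b → toℚ (a ℤ.+ b) ≡ toℚ a +ℚ toℚ b
toℚ-+ a b = ℚ.toℚᵘ-injective (ℚᵘ.≃-trans (*≡* a+b≡a+b) (ℚᵘ.≃-sym (ℚ.toℚᵘ-homo-+ (toℚ a) (toℚ b))))
  where
  a+b≡a+b : (a ℤ.+ b) ℤ.* + 1 ≡ (a ℤ.* + 1 ℤ.+ b ℤ.* + 1) ℤ.* + 1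
  a+b≡a+b = cong (ℤ._* + 1) (sym (cong₂ ℤ._+_ (ℤ.*-identityʳ a) (ℤ.*-identityʳ b)))

toℚ-sum : ∀ {A : Set} (G : A → ℤ) (L : List A) → toℚ (sumℤ (List.map G L)) ≡ sumℚ (List.map (toℚ ∘ G) L)
toℚ-sum G []      = refl
toℚ-sum G (a ∷ L) = trans (toℚ-+ (G a) _) (cong (toℚ (G a) +ℚ_) (toℚ-sum G L))

±1 : Bool → ℚ
±1 b = toℚ (sign b)

±1-xor : ∀ a b → ±1 (a xor b) ≡ ±1 a *ℚ ±1 b
±1-xor false false = refl
±1-xor false true  = refl
±1-xor true  false = refl
±1-xor true  true  = refl

±1≡1-2b : ∀ b → ±1 b ≡ 1ℚ +ℚ (- toℚ (+ 2)) *ℚ b2q b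
±1≡1-2b false = refl
±1≡1-2b true  = refl

sumℚ-++ : ∀ (xs ys : List ℚ) → sumℚ (xs List.++ ys) ≡ sumℚ xs +ℚ sumℚ ys
sumℚ-++ []       ys = sym (ℚ.+-identityˡ _)
sumℚ-++ (x ∷ xs) ys = trans (cong (x +ℚ_) (sumℚ-++ xs ys)) (sym (ℚ.+-assoc x _ _))

module _ {A : Set} where

  sumℚ-map-cong : ∀ {F G : A → ℚ} → (∀ a → F a ≡ G a) → ∀ L → sumℚ (List.map F L) ≡ sumℚ (List.map G L)
  sumℚ-map-cong F≗G L = cong sumℚ (List.map-cong F≗G L)

  sumℚ-map-0 : ∀ (L : List A) → sumℚ (List.map (λ _ → 0ℚ) L) ≡ 0ℚ
  sumℚ-map-0 []      = refl
  sumℚ-map-0 (a ∷ L) = cong (0ℚ +ℚ_) (sumℚ-map-0 L)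

  sumℚ-map-*ˡ : ∀ c (F : A → ℚ) L → sumℚ (List.map (λ a → c *ℚ F a) L) ≡ c *ℚ sumℚ (List.map F L)
  sumℚ-map-*ˡ c F []      = sym (ℚ.*-zeroʳ c)
  sumℚ-map-*ˡ c F (a ∷ L) = trans (cong (c *ℚ F a +ℚ_) (sumℚ-map-*ˡ c F L)) (sym (ℚ.*-distribˡ-+ c _ _))

  sumℚ-map-+ : ∀ (F G : A → ℚ) L →
    sumℚ (List.map (λ a → F a +ℚ G a) L) ≡ sumℚ (List.map F L) +ℚ sumℚ (List.map G L)
  sumℚ-map-+ F G []      = refl
  sumℚ-map-+ F G (a ∷ L) = trans (cong (F a +ℚ G a +ℚ_) (sumℚ-map-+ F G L)) (solve 4
    (λ x y z w → (x :+ y) :+ (z :+ w) := (x :+ z) :+ (y :+ w)) refl (F a) (G a) _ _)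
    where open +-*-Solver

Σ-cube : ∀ n → (Vec Bool n → ℚ) → ℚ
Σ-cube n F = sumℚ (List.map F (allVecs n))

Σ-cube-suc : ∀ n F → Σ-cube (suc n) F ≡ Σ-cube n (F ∘ (false ∷_)) +ℚ Σ-cube n (F ∘ (true ∷_))
Σ-cube-suc n F = begin
  sumℚ (List.map F (List.map (false ∷_) xs List.++ List.map (true ∷_) xs))
    ≡⟨ cong sumℚ (List.map-++ F (List.map (false ∷_) xs) _) ⟩
  sumℚ (List.map F (List.map (false ∷_) xs) List.++ List.map F (List.map (true ∷_) xs))
    ≡⟨ sumℚ-++ (List.map F (List.map (false ∷_) xs)) _ ⟩
  sumℚ (List.map F (List.map (false ∷_) xs)) +ℚ sumℚ (List.map F (List.map (true ∷_) xs))
    ≡⟨ sym (cong₂ _+ℚ_ (cong sumℚ (List.map-∘ xs)) (cong sumℚ (List.map-∘ xs))) ⟩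
  Σ-cube n (F ∘ (false ∷_)) +ℚ Σ-cube n (F ∘ (true ∷_)) ∎
  where open ≡-Reasoning
        xs = allVecs n

Σ-cube-++ : ∀ k m F → Σ-cube (k + m) F ≡ Σ-cube k (λ y → Σ-cube m (λ z → F (y ++ z)))
Σ-cube-++ zero    m F = sym (ℚ.+-identityʳ _)
Σ-cube-++ (suc k) m F = trans (Σ-cube-suc (k + m) F) (trans
  (cong₂ _+ℚ_ (Σ-cube-++ k m (F ∘ (false ∷_))) (Σ-cube-++ k m (F ∘ (true ∷_))))
  (sym (Σ-cube-suc k _)))

weight≤length : ∀ {n} (v : Vec Bool n) → weight v ≤ n
weight≤length []          = z≤n
weight≤length (true  ∷ v) = s≤s (weight≤length v)
weight≤length (false ∷ v) = m≤n⇒m≤1+n (weight≤length v)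

character : ∀ {n} → Vec Bool n → Vec Bool n → ℚ
character v x = ±1 (dot v x)

fourier : ∀ {n} → (Vec Bool n → ℚ) → Vec Bool n → ℚ
fourier {n} h v = Σ-cube n (λ x → h x *ℚ character v x)

record Degree≤ {n} (D : ℕ) (h : Vec Bool n → ℚ) : Set where
  constructor vanishing
  field vanishes : ∀ v → D < weight v → fourier h v ≡ 0ℚ

open Degree≤

module _ {n : ℕ} where

  degree≤-mono : ∀ {D D′} {h : Vec Bool n → ℚ} → D ≤ D′ → Degree≤ D h → Degree≤ D′ h
  degree≤-mono D≤D′ hD = vanishing λ v lt → vanishes hD v (≤-<-trans D≤D′ lt)

  degree≤-cong : ∀ {D} {h h′ : Vec Bool n → ℚ} → (∀ x → h x ≡ h′ x) → Degree≤ D h → Degree≤ D h′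
  degree≤-cong h≗h′ hD = vanishing λ v lt →
    trans (sumℚ-map-cong (λ x → cong (_*ℚ _) (sym (h≗h′ x))) (allVecs n)) (vanishes hD v lt)

  degree≤-length : (h : Vec Bool n → ℚ) → Degree≤ n h
  degree≤-length h = vanishing λ v n<wv → contradiction (weight≤length v) (<⇒≱ n<wv)

  degree≤-0 : ∀ {D} → Degree≤ D (λ (_ : Vec Bool n) → 0ℚ)
  degree≤-0 = vanishing λ v _ →
    trans (sumℚ-map-cong (λ x → ℚ.*-zeroˡ (character v x)) (allVecs n)) (sumℚ-map-0 (allVecs n))

  degree≤-*ˡ : ∀ {D} c {h : Vec Bool n → ℚ} → Degree≤ D h → Degree≤ D (λ x → c *ℚ h x)
  degree≤-*ˡ c {h} hD = vanishing λ v lt → begin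
    Σ-cube n (λ x → c *ℚ h x *ℚ character v x)   ≡⟨ sumℚ-map-cong (λ x → ℚ.*-assoc c (h x) _) (allVecs n) ⟩
    Σ-cube n (λ x → c *ℚ (h x *ℚ character v x)) ≡⟨ sumℚ-map-*ˡ c _ (allVecs n) ⟩
    c *ℚ fourier h v                             ≡⟨ cong (c *ℚ_) (vanishes hD v lt) ⟩
    c *ℚ 0ℚ                                      ≡⟨ ℚ.*-zeroʳ c ⟩
    0ℚ                                           ∎
    where open ≡-Reasoning

  degree≤-+ : ∀ {D} {h g : Vec Bool n → ℚ} → Degree≤ D h → Degree≤ D g → Degree≤ D (λ x → h x +ℚ g x)
  degree≤-+ {h = h} {g} hD gD = vanishing λ v lt → begin
    Σ-cube n (λ x → (h x +ℚ g x) *ℚ character v x)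
      ≡⟨ sumℚ-map-cong (λ x → ℚ.*-distribʳ-+ (character v x) (h x) (g x)) (allVecs n) ⟩
    Σ-cube n (λ x → h x *ℚ character v x +ℚ g x *ℚ character v x)
      ≡⟨ sumℚ-map-+ _ _ (allVecs n) ⟩
    fourier h v +ℚ fourier g v
      ≡⟨ cong₂ _+ℚ_ (vanishes hD v lt) (vanishes gD v lt) ⟩
    0ℚ ∎
    where open ≡-Reasoning

  degree≤-sum : ∀ {A : Set} {D} (G : A → Vec Bool n → ℚ) → (∀ a → Degree≤ D (G a)) →
    ∀ L → Degree≤ D (λ x → sumℚ (List.map (λ a → G a x) L))
  degree≤-sum G GD []      = degree≤-0
  degree≤-sum G GD (a ∷ L) = degree≤-+ (GD a) (degree≤-sum G GD L)

take-++ : ∀ {A : Set} {k m} (y : Vec A k) (z : Vec A m) → take k (y ++ z) ≡ y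
take-++ []      z = refl
take-++ (a ∷ y) z = cong (a ∷_) (take-++ y z)

drop-++ : ∀ {A : Set} {k m} (y : Vec A k) (z : Vec A m) → drop k (y ++ z) ≡ z
drop-++ []      z = refl
drop-++ (a ∷ y) z = drop-++ y z

dot-++ : ∀ k {m} (v : Vec Bool (k + m)) (y : Vec Bool k) (z : Vec Bool m) →
  dot v (y ++ z) ≡ dot (take k v) y xor dot (drop k v) z
dot-++ zero    v       []      z = refl
dot-++ (suc k) (b ∷ v) (a ∷ y) z = trans (cong ((b ∧ a) xor_) (dot-++ k v y z)) (sym (xor-assoc (b ∧ a) _ _))

weight-++ : ∀ k {m} (v : Vec Bool (k + m)) → weight v ≡ weight (take k v) + weight (drop k v)
weight-++ zero    v           = refl
weight-++ (suc k) (true  ∷ v) = cong suc (weight-++ k v)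
weight-++ (suc k) (false ∷ v) = weight-++ k v

fourier-⊗ : ∀ k {m} (h : Vec Bool k → ℚ) (g : Vec Bool m → ℚ) v →
  fourier (λ x → h (take k x) *ℚ g (drop k x)) v ≡ fourier h (take k v) *ℚ fourier g (drop k v)
fourier-⊗ k {m} h g v = begin
  Σ-cube (k + m) (λ x → h (take k x) *ℚ g (drop k x) *ℚ character v x)
    ≡⟨ Σ-cube-++ k m _ ⟩
  Σ-cube k (λ y → Σ-cube m (λ z → h (take k (y ++ z)) *ℚ g (drop k (y ++ z)) *ℚ character v (y ++ z)))
    ≡⟨ sumℚ-map-cong (λ y → sumℚ-map-cong (separate y) (allVecs m)) (allVecs k) ⟩
  Σ-cube k (λ y → Σ-cube m (λ z → (h y *ℚ character v₁ y) *ℚ (g z *ℚ character v₂ z)))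
    ≡⟨ sumℚ-map-cong (λ y → sumℚ-map-*ˡ (h y *ℚ character v₁ y) _ (allVecs m)) (allVecs k) ⟩
  Σ-cube k (λ y → (h y *ℚ character v₁ y) *ℚ fourier g v₂)
    ≡⟨ sumℚ-map-cong (λ y → ℚ.*-comm (h y *ℚ character v₁ y) _) (allVecs k) ⟩
  Σ-cube k (λ y → fourier g v₂ *ℚ (h y *ℚ character v₁ y))
    ≡⟨ sumℚ-map-*ˡ (fourier g v₂) _ (allVecs k) ⟩
  fourier g v₂ *ℚ fourier h v₁
    ≡⟨ ℚ.*-comm (fourier g v₂) _ ⟩
  fourier h v₁ *ℚ fourier g v₂ ∎
  where
  open ≡-Reasoning
  v₁ = take k v
  v₂ = drop k v
  separate : ∀ y z → h (take k (y ++ z)) *ℚ g (drop k (y ++ z)) *ℚ character v (y ++ z)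
                   ≡ (h y *ℚ character v₁ y) *ℚ (g z *ℚ character v₂ z)
  separate y z = begin
    h (take k (y ++ z)) *ℚ g (drop k (y ++ z)) *ℚ ±1 (dot v (y ++ z))
      ≡⟨ cong₂ (λ a b → h a *ℚ g b *ℚ ±1 (dot v (y ++ z))) (take-++ y z) (drop-++ y z) ⟩
    h y *ℚ g z *ℚ ±1 (dot v (y ++ z))
      ≡⟨ cong (λ t → h y *ℚ g z *ℚ ±1 t) (dot-++ k v y z) ⟩
    h y *ℚ g z *ℚ ±1 (dot v₁ y xor dot v₂ z)
      ≡⟨ cong (h y *ℚ g z *ℚ_) (±1-xor (dot v₁ y) (dot v₂ z)) ⟩
    h y *ℚ g z *ℚ (character v₁ y *ℚ character v₂ z)
      ≡⟨ solve 4 (λ a b c d → (a :* b) :* (c :* d) := (a :* c) :* (b :* d)) refl (h y) (g z) _ _ ⟩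
    (h y *ℚ character v₁ y) *ℚ (g z *ℚ character v₂ z) ∎
    where open +-*-Solver

split-< : ∀ {a b x y} → a + b < x + y → a < x ⊎ b < y
split-< {a} {b} {x} {y} lt with a <? x | b <? y
... | yes a<x | _       = inj₁ a<x
... | no _    | yes b<y = inj₂ b<y
... | no a≮x  | no b≮y  = contradiction lt (≤⇒≯ (+-mono-≤ (≮⇒≥ a≮x) (≮⇒≥ b≮y)))

degree≤-⊗ : ∀ {k m a b} {h : Vec Bool k → ℚ} {g : Vec Bool m → ℚ} →
  Degree≤ a h → Degree≤ b g → Degree≤ (a + b) (λ x → h (take k x) *ℚ g (drop k x))
degree≤-⊗ {k} {m} {a} {b} {h} {g} hD gD = vanishing λ v lt →
  trans (fourier-⊗ k h g v) (vanish v (split-< (subst (a + b <_) (weight-++ k v) lt)))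
  where
  vanish : ∀ v → a < weight (take k v) ⊎ b < weight (drop k v) →
    fourier h (take k v) *ℚ fourier g (drop k v) ≡ 0ℚ
  vanish v (inj₁ lt₁) =
    trans (cong (_*ℚ fourier g (drop k v)) (vanishes hD (take k v) lt₁)) (ℚ.*-zeroˡ (fourier g (drop k v)))
  vanish v (inj₂ lt₂) =
    trans (cong (fourier h (take k v) *ℚ_) (vanishes gD (drop k v) lt₂)) (ℚ.*-zeroʳ (fourier h (take k v)))

degree≤-1 : ∀ n → Degree≤ 0 (λ (_ : Vec Bool n) → 1ℚ)
degree≤-1 zero    = degree≤-length (λ _ → 1ℚ)
degree≤-1 (suc n) = degree≤-cong (λ _ → ℚ.*-identityˡ 1ℚ)
  (degree≤-⊗ {1} {n} one-bit (degree≤-1 n))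
  where
  one-bit : Degree≤ 0 (λ (_ : Vec Bool 1) → 1ℚ)
  one-bit = vanishing λ where
    (true  ∷ []) _  → refl
    (false ∷ []) ()

PolyDegree≤ : ∀ {d} → (Vec Bool d → Bool) → ℕ → Set
PolyDegree≤ {d} f p = Σ (Vec Bool d → ℚ) λ c →
  (∀ x → polyEval c x ≡ b2q (f x)) × (∀ S → p < weight S → c S ≡ 0ℚ)

degree≤-monomial∘chop : ∀ d k {q} (F : Vec Bool k → Bool) → Degree≤ q (b2q ∘ F) →
  ∀ S → Degree≤ (weight S * q) (λ x → monomial S (map F (chop d k x)))
degree≤-monomial∘chop zero    k F FD []          = degree≤-length _
degree≤-monomial∘chop (suc d) k F FD (true  ∷ S) =
  degree≤-⊗ {k} {d * k} FD (degree≤-monomial∘chop d k F FD S)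
degree≤-monomial∘chop (suc d) k F FD (false ∷ S) = degree≤-cong (λ _ → ℚ.*-identityˡ _)
  (degree≤-⊗ {k} {d * k} (degree≤-1 k) (degree≤-monomial∘chop d k F FD S))

degree≤-∘chop : ∀ {d k p q} {f : Vec Bool d → Bool} (F : Vec Bool k → Bool) →
  PolyDegree≤ f p → Degree≤ q (b2q ∘ F) → Degree≤ (p * q) (λ x → b2q (f (map F (chop d k x))))
degree≤-∘chop {d} {k} {p} {q} F (c , represents , high-zero) FD =
  degree≤-cong (λ x → represents (map F (chop d k x))) (degree≤-sum term termD (allVecs d))
  where
  term : Vec Bool d → Vec Bool (d * k) → ℚ
  term S x = c S *ℚ monomial S (map F (chop d k x))
  termD : ∀ S → Degree≤ (p * q) (term S)
  termD S with weight S ≤? p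
  ... | yes wS≤p = degree≤-*ˡ (c S) (degree≤-mono (*-monoˡ-≤ q wS≤p) (degree≤-monomial∘chop d k F FD S))
  ... | no  wS≰p = degree≤-cong (λ x → sym (term≡0 x)) degree≤-0
    where
    term≡0 : ∀ x → term S x ≡ 0ℚ
    term≡0 x = trans (cong (_*ℚ _) (high-zero S (≰⇒> wS≰p))) (ℚ.*-zeroˡ (monomial S (map F (chop d k x))))

degree≤-fIter : ∀ {d p} {f : Vec Bool d → Bool} → PolyDegree≤ f p → ∀ u → Degree≤ (p ^ u) (b2q ∘ fIter f u)
degree≤-fIter {f = f} fp zero    = degree≤-length (b2q ∘ fIter f zero)
degree≤-fIter {f = f} fp (suc u) = degree≤-∘chop {f = f} (fIter f u) fp (degree≤-fIter fp u)

parity-xor-dot : ∀ {n} (w x : Vec Bool n) → parity x xor dot w x ≡ dot (map not w) x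
parity-xor-dot []      []      = refl
parity-xor-dot (b ∷ w) (a ∷ x) = begin
  (a xor parity x) xor ((b ∧ a) xor dot w x)   ≡⟨ interchange a (parity x) (b ∧ a) (dot w x) ⟩
  (a xor (b ∧ a)) xor (parity x xor dot w x)   ≡⟨ cong₂ _xor_ (a-xor-b∧a b a) (parity-xor-dot w x) ⟩
  (not b ∧ a) xor dot (map not w) x            ∎
  where
  open ≡-Reasoning
  a-xor-b∧a : ∀ b a → a xor (b ∧ a) ≡ not b ∧ a
  a-xor-b∧a false a     = xor-identityʳ a
  a-xor-b∧a true  false = refl
  a-xor-b∧a true  true  = refl

weight-map-not : ∀ {n} (w : Vec Bool n) → weight w + weight (map not w) ≡ n
weight-map-not []          = refl
weight-map-not (true  ∷ w) = cong suc (weight-map-not w)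
weight-map-not (false ∷ w) = trans (+-suc (weight w) _) (cong suc (weight-map-not w))

walsh-⊕parity : ∀ {n} (h : Vec Bool n → Bool) w →
  toℚ (walsh (λ x → h x xor parity x) w) ≡ fourier (±1 ∘ h) (map not w)
walsh-⊕parity {n} h w = trans (toℚ-sum _ (allVecs n)) (sumℚ-map-cong signs (allVecs n))
  where
  open ≡-Reasoning
  signs : ∀ x → ±1 ((h x xor parity x) xor dot w x) ≡ ±1 (h x) *ℚ character (map not w) x
  signs x = begin
    ±1 ((h x xor parity x) xor dot w x)  ≡⟨ cong ±1 (xor-assoc (h x) (parity x) (dot w x)) ⟩
    ±1 (h x xor (parity x xor dot w x))  ≡⟨ cong (λ t → ±1 (h x xor t)) (parity-xor-dot w x) ⟩
    ±1 (h x xor dot (map not w) x)       ≡⟨ ±1-xor (h x) _ ⟩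
    ±1 (h x) *ℚ character (map not w) x  ∎

degree≤-±1 : ∀ {n D} {h : Vec Bool n → Bool} → Degree≤ D (b2q ∘ h) → Degree≤ D (±1 ∘ h)
degree≤-±1 {n} {h = h} hD = degree≤-cong (λ x → sym (±1≡1-2b (h x)))
  (degree≤-+ (degree≤-mono z≤n (degree≤-1 n)) (degree≤-*ˡ (- toℚ (+ 2)) hD))

<-complement : ∀ {a b n P} → a + b ≡ n → P < n → a ≤ n ∸ P ∸ 1 → P < b
<-complement {a} {b} {n} {P} a+b≡n P<n a≤n∸P∸1 = +-cancelˡ-≤ a (suc P) b (begin
  a + suc P          ≤⟨ +-monoˡ-≤ (suc P) a≤n∸[1+P] ⟩
  n ∸ suc P + suc P  ≡⟨ m∸n+n≡m P<n ⟩
  n                  ≡⟨ sym a+b≡n ⟩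
  a + b              ∎)
  where
  open ≤-Reasoning
  a≤n∸[1+P] : a ≤ n ∸ suc P
  a≤n∸[1+P] = subst (a ≤_) (trans (∸-+-assoc n P 1) (cong (n ∸_) (+-comm P 1))) a≤n∸P∸1

resilient-⊕parity : ∀ {n D} {h : Vec Bool n → Bool} → Degree≤ D (b2q ∘ h) → D < n →
  Resilient (λ x → h x xor parity x) (n ∸ D ∸ 1)
resilient-⊕parity {h = h} hD D<n w weight≤ = cong ↥_ (begin
  toℚ (walsh (λ x → h x xor parity x) w)  ≡⟨ walsh-⊕parity h w ⟩
  fourier (±1 ∘ h) (map not w)            ≡⟨ vanishes (degree≤-±1 {h = h} hD) (map not w) D<weight ⟩
  0ℚ                                      ∎)
  where
  open ≡-Reasoning
  D<weight : _ < weight (map not w)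
  D<weight = <-complement (weight-map-not w) D<n weight≤

Fn : ℕ → Set
Fn n = Vec Bool n → Bool

evalAll : ∀ {n m} → Vec (Fn n) m → Vec Bool n → Vec Bool m
evalAll hs x = map (λ h → h x) hs

record Wire {n k} (c : Circ n k) (h : Fn n) (D : ℕ) : Set where
  constructor wire
  field
    index    : Fin k
    computes : ∀ x → lookup (wires c x) index ≡ h x
    depth≤   : lookup (depths c) index ≤ D


module _ {n k} {c : Circ n k} {h : Fn n} {D : ℕ} where

  Wire-cong : ∀ {h′} → (∀ x → h x ≡ h′ x) → Wire c h D → Wire c h′ D
  Wire-cong h≗h′ (wire i w≗h d≤D) = wire i (λ x → trans (w≗h x) (h≗h′ x)) d≤D

  Wire-≤ : ∀ {D′} → D ≤ D′ → Wire c h D → Wire c h D′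
  Wire-≤ D≤D′ (wire i w≗h d≤D) = wire i w≗h (≤-trans d≤D D≤D′)

data Extension {n k} (c : Circ n k) : ∀ {k′} → Circ n k′ → Set where
  here   : Extension c c
  extend : ∀ {k′} {c′ : Circ n k′} → Extension c c′ → (g : Gate k′) → Extension c (c′ ▷ g)

gatesAdded : ∀ {n k k′} {c : Circ n k} {c′ : Circ n k′} → Extension c c′ → ℕ
gatesAdded here         = 0
gatesAdded (extend e _) = suc (gatesAdded e)

_++ᴱ_ : ∀ {n k k′ k″} {c : Circ n k} {c′ : Circ n k′} {c″ : Circ n k″} →
  Extension c c′ → Extension c′ c″ → Extension c c″
e ++ᴱ here          = e
e ++ᴱ extend e′ g = extend (e ++ᴱ e′) g

gatesAdded-++ᴱ : ∀ {n k k′ k″} {c : Circ n k} {c′ : Circ n k′} {c″ : Circ n k″}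
  (e : Extension c c′) (e′ : Extension c′ c″) → gatesAdded (e ++ᴱ e′) ≡ gatesAdded e + gatesAdded e′
gatesAdded-++ᴱ e here          = sym (+-identityʳ _)
gatesAdded-++ᴱ e (extend e′ g) = trans (cong suc (gatesAdded-++ᴱ e e′)) (sym (+-suc _ _))

weaken : ∀ {n k k′} {c : Circ n k} {c′ : Circ n k′} {h D} → Extension c c′ → Wire c h D → Wire c′ h D
weaken here         w = w
weaken (extend e g) w = let wire i w≗h d≤D = weaken e w in wire (suc i) w≗h d≤D

gates≡gatesAdded : ∀ {n k} {c : Circ n k} (e : Extension inputs c) → gates c ≡ gatesAdded e
gates≡gatesAdded here         = refl
gates≡gatesAdded (extend e g) = cong suc (gates≡gatesAdded e)

Wires : ∀ {n k m} → Circ n k → Vec (Fn n) m → ℕ → Set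
Wires c hs D = All (λ h → Wire c h D) hs

weakenAll : ∀ {n k k′ m} {c : Circ n k} {c′ : Circ n k′} {hs : Vec (Fn n) m} {D} →
  Extension c c′ → Wires c hs D → Wires c′ hs D
weakenAll e = All.map (weaken e)

record Build {n k} (c : Circ n k) (s : ℕ) (P : ∀ {k′} → Circ n k′ → Set) : Set where
  constructor building
  field
    {k′}      : ℕ
    {result}  : Circ n k′
    extension : Extension c result
    bounded   : gatesAdded extension ≤ s
    property  : P result

module _ {n k} {c : Circ n k} {P : ∀ {k′} → Circ n k′ → Set} where

  build-pure : P c → Build c 0 P
  build-pure p = building here z≤n p

  build-map : ∀ {s} {Q : ∀ {k′} → Circ n k′ → Set} →
    (∀ {k′} {c′ : Circ n k′} → Extension c c′ → P c′ → Q c′) → Build c s P → Build c s Q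
  build-map F (building e bounded p) = building e bounded (F e p)

  build-bind : ∀ {s t} {Q : ∀ {k′} → Circ n k′ → Set} → Build c s P →
    (∀ {k′} {c′ : Circ n k′} → Extension c c′ → P c′ → Build c′ t Q) → Build c (s + t) Q
  build-bind {s} {t} (building e e≤s p) κ = let building e′ e′≤t q = κ e p in
    building (e ++ᴱ e′) (subst (_≤ s + t) (sym (gatesAdded-++ᴱ e e′)) (+-mono-≤ e≤s e′≤t)) q

Gadget : ∀ {m} → (Vec Bool m → Bool) → (s t : ℕ) → Set
Gadget {m} φ s t = ∀ {n k} (c : Circ n k) (hs : Vec (Fn n) m) D → Wires c hs D →
  Build c s (λ c′ → Wire c′ (φ ∘ evalAll hs) (t + D))

gadget-cong : ∀ {m s t} {φ ψ : Vec Bool m → Bool} → (∀ y → φ y ≡ ψ y) → Gadget φ s t → Gadget ψ s t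
gadget-cong φ≗ψ G c hs D ws = build-map (λ _ → Wire-cong (φ≗ψ ∘ evalAll hs)) (G c hs D ws)

mux-correct : ∀ h a b → (not h ∧ a) ∨ (h ∧ b) ≡ (if h then b else a)
mux-correct false a b = ∨-identityʳ a
mux-correct true  a b = refl

mux : ∀ {n k D} {c : Circ n k} {h a b : Fn n} → Wire c h D → Wire c a D → Wire c b D →
  Build c 4 (λ c′ → Wire c′ (λ x → if h x then b x else a x) (3 + D))
mux {c = c} {h} {a} {b} (wire i i≗h dᵢ) (wire j j≗a dⱼ) (wire l l≗b dₗ) =
  -- Fin indices count back from the newest wire, so each new gate shifts the older ones by one.
  building (extend (extend (extend (extend here (NOT i)) (AND zero (suc j))) (AND (suc (suc i)) (suc (suc l))))
                   (OR (suc zero) zero))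
           ≤-refl
           (wire zero value (s≤s (⊔-lub (s≤s (⊔-lub (s≤s dᵢ) (m≤n⇒m≤1+n dⱼ))) (m≤n⇒m≤1+n (s≤s (⊔-lub dᵢ dₗ))))))
  where
  value : ∀ x → let w = lookup (wires c x) in
    (not (w i) ∧ w j) ∨ (w i ∧ w l) ≡ (if h x then b x else a x)
  value x = trans (cong₂ _∨_ (cong₂ _∧_ (cong not (i≗h x)) (j≗a x)) (cong₂ _∧_ (i≗h x) (l≗b x)))
                  (mux-correct (h x) (a x) (b x))

shannonSize : ℕ → ℕ
shannonSize zero    = 1
shannonSize (suc m) = shannonSize m + (shannonSize m + 4)

shannon : ∀ m (φ : Vec Bool m → Bool) → Gadget φ (shannonSize m) (m * 3)
shannon zero    φ c []       D []       =
  building (extend here (const (φ []))) ≤-refl (wire zero (λ _ → refl) z≤n)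
shannon (suc m) φ c (h ∷ hs) D (w ∷ ws) =
  build-bind (shannon m (φ ∘ (false ∷_)) c hs D ws) λ e₁ w₀ →
  build-bind (shannon m (φ ∘ (true ∷_)) _ hs D (weakenAll e₁ ws)) λ e₂ w₁ →
  build-map (λ _ → Wire-cong λ x → expansion (h x) (evalAll hs x))
    (mux (Wire-≤ (m≤n+m D (m * 3)) (weaken (e₁ ++ᴱ e₂) w)) (weaken e₂ w₀) w₁)
  where
  expansion : ∀ b v → (if b then φ (true ∷ v) else φ (false ∷ v)) ≡ φ (b ∷ v)
  expansion false v = refl
  expansion true  v = refl

All-chop : ∀ {A : Set} {P : A → Set} d K {ys : Vec A (d * K)} → All P ys → All (All P) (chop d K ys)
All-chop zero    K ps = []
All-chop (suc d) K ps = All.take⁺ K ps ∷ All-chop d K (All.drop⁺ K ps)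

evalAll-chop : ∀ {n} d K (ψ : Vec Bool K → Bool) (hs : Vec (Fn n) (d * K)) x →
  evalAll (map (λ b → ψ ∘ evalAll b) (chop d K hs)) x ≡ map ψ (chop d K (evalAll hs x))
evalAll-chop zero    K ψ hs x = refl
evalAll-chop (suc d) K ψ hs x = cong₂ _∷_ (cong ψ (sym (take-map (λ h → h x) K hs)))
  (trans (evalAll-chop d K ψ (drop K hs) x) (cong (map ψ ∘ chop d K) (sym (drop-map (λ h → h x) K hs))))

gadget-blocks : ∀ {K s t} {ψ : Vec Bool K → Bool} → Gadget ψ s t →
  ∀ {n k m D} {c : Circ n k} (bs : Vec (Vec (Fn n) K) m) → All (λ b → Wires c b D) bs →
  Build c (m * s) (λ c′ → Wires c′ (map (λ b → ψ ∘ evalAll b) bs) (t + D))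
gadget-blocks G []       []       = build-pure []
gadget-blocks {ψ = ψ} G (b ∷ bs) (w ∷ ws) =
  build-bind (G _ b _ w) λ e w₀ →
  build-map (λ e′ → weaken e′ w₀ ∷_) (gadget-blocks {ψ = ψ} G bs (All.map (weakenAll e) ws))

gadget-∘chop : ∀ {d K s s′ t t′} {ψ : Vec Bool K → Bool} {φ : Vec Bool d → Bool} →
  Gadget ψ s t → Gadget φ s′ t′ → Gadget (λ y → φ (map ψ (chop d K y))) (d * s + s′) (t′ + t)
gadget-∘chop {d} {K} {t = t} {t′} {ψ} {φ} G H c hs D ws =
  build-bind (gadget-blocks {ψ = ψ} G (chop d K hs) (All-chop d K ws)) λ _ ws′ →
  build-map (λ _ → Wire-cong (cong φ ∘ evalAll-chop d K ψ hs) ∘ Wire-≤ (≤-reflexive (sym (+-assoc t′ t D))))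
    (H _ (map (λ b → ψ ∘ evalAll b) (chop d K hs)) (t + D) ws′)

iterSize : ℕ → ℕ → ℕ → ℕ
iterSize d s zero    = 0
iterSize d s (suc i) = d * iterSize d s i + s

gadget-fIter : ∀ {d s t} {φ : Vec Bool d → Bool} → Gadget φ s t →
  ∀ i → Gadget (fIter φ i) (iterSize d s i) (i * t)
gadget-fIter G zero    c (h ∷ []) D (w ∷ []) = build-pure w
gadget-fIter {φ = φ} G (suc i)               = gadget-∘chop {ψ = fIter φ i} {φ} (gadget-fIter G i) G

gadget-pair : ∀ {m s₁ s₂ s t t′} {ψ₁ ψ₂ : Vec Bool m → Bool} {φ : Vec Bool 2 → Bool} →
  Gadget ψ₁ s₁ t → Gadget ψ₂ s₂ t → Gadget φ s t′ →
  Gadget (λ y → φ (ψ₁ y ∷ ψ₂ y ∷ [])) (s₁ + (s₂ + s)) (t′ + t)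
gadget-pair {t = t} {t′} {ψ₁} {ψ₂} G₁ G₂ H c hs D ws =
  build-bind (G₁ c hs D ws) λ e₁ w₁ →
  build-bind (G₂ _ hs D (weakenAll e₁ ws)) λ e₂ w₂ →
  build-map (λ _ → Wire-≤ (≤-reflexive (sym (+-assoc t′ t D))))
    (H _ (ψ₁ ∘ evalAll hs ∷ ψ₂ ∘ evalAll hs ∷ []) (t + D) (weaken e₂ w₁ ∷ w₂ ∷ []))

HasCircuit : ∀ {n} → (Vec Bool n → Bool) → (s t : ℕ) → Set
HasCircuit {n} h s t = Σ (Circuit n) λ C → Computes C h × size C ≤ s × depth C ≤ t

HasCircuit-mono : ∀ {n s s′ t t′} {h : Vec Bool n → Bool} →
  s ≤ s′ → t ≤ t′ → HasCircuit h s t → HasCircuit h s′ t′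
HasCircuit-mono s≤s′ t≤t′ (C , computes , size≤ , depth≤) =
  C , computes , ≤-trans size≤ s≤s′ , ≤-trans depth≤ t≤t′

projections : ∀ n → Vec (Fn n) n
projections n = tabulate (λ i x → lookup x i)

evalAll-projections : ∀ {n} (x : Vec Bool n) → evalAll (projections n) x ≡ x
evalAll-projections x = trans (sym (tabulate-∘ (λ h → h x) (λ i x → lookup x i))) (tabulate∘lookup x)

input-wires : ∀ n → Wires inputs (projections n) 0
input-wires n = All.lookup⁻ λ i →
  Wire-cong (λ x → cong (λ h → h x) (sym (lookup∘tabulate (λ i x → lookup x i) i)))
            (wire i (λ _ → refl) (≤-reflexive (lookup-replicate i 0)))

circuit-of-gadget : ∀ {n s t} {h : Vec Bool n → Bool} → Gadget h s t → HasCircuit h s t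
circuit-of-gadget {n} {s} {t} {h} G =
  let building e e≤s (wire i computes depth≤) = G inputs (projections n) 0 (input-wires n) in
  circuit _ _ i ,
  (λ x → trans (computes x) (cong h (evalAll-projections x))) ,
  subst (_≤ s) (sym (gates≡gatesAdded e)) e≤s ,
  subst (_ ≤_) (+-identityʳ t) depth≤

parity-++ : ∀ {k m} (y : Vec Bool k) (z : Vec Bool m) → parity (y ++ z) ≡ parity y xor parity z
parity-++ []      z = refl
parity-++ (a ∷ y) z = trans (cong (a xor_) (parity-++ y z)) (sym (xor-assoc a _ _))

parity-chop : ∀ d K (x : Vec Bool (d * K)) → parity (map parity (chop d K x)) ≡ parity x
parity-chop zero    K [] = refl
parity-chop (suc d) K x  = begin
  parity (take K x) xor parity (map parity (chop d K (drop K x)))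
    ≡⟨ cong (parity (take K x) xor_) (parity-chop d K (drop K x)) ⟩
  parity (take K x) xor parity (drop K x)
    ≡⟨ sym (parity-++ (take K x) (drop K x)) ⟩
  parity (take K x ++ drop K x)
    ≡⟨ cong parity (take++drop≡id K x) ⟩
  parity x ∎
  where open ≡-Reasoning

fIter-parity : ∀ {d} i (x : Vec Bool (d ^ i)) → fIter {d} parity i x ≡ parity x
fIter-parity zero        (a ∷ []) = sym (xor-identityʳ a)
fIter-parity {d} (suc i) x        =
  trans (cong parity (map-cong (fIter-parity i) (chop d (d ^ i) x))) (parity-chop d (d ^ i) x)

xor₂ : Vec Bool 2 → Bool
xor₂ (a ∷ b ∷ []) = a xor b

gadget-gIter : ∀ {d} (f : Vec Bool d → Bool) u → let S = iterSize d (shannonSize d) u in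
  Gadget (gIter f u) (S + (S + shannonSize 2)) (2 * 3 + u * (d * 3))
gadget-gIter {d} f u = gadget-cong (λ y → cong (fIter f u y xor_) (fIter-parity u y))
  (gadget-pair {ψ₁ = fIter f u} {fIter parity u} {xor₂}
    (gadget-fIter (shannon d f) u) (gadget-fIter (shannon d parity) u) (shannon 2 xor₂))

iterSize-bound : ∀ {d} s → 2 ≤ d → ∀ u → iterSize d s u + s ≤ s * d ^ u
iterSize-bound {d} s 2≤d zero    = ≤-reflexive (sym (*-identityʳ s))
iterSize-bound {d} s 2≤d (suc u) = begin
  d * iterSize d s u + s + s   ≡⟨ +-assoc (d * iterSize d s u) s s ⟩
  d * iterSize d s u + (s + s) ≤⟨ +-monoʳ-≤ (d * iterSize d s u) s+s≤d*s ⟩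
  d * iterSize d s u + d * s   ≡⟨ sym (*-distribˡ-+ d (iterSize d s u) s) ⟩
  d * (iterSize d s u + s)     ≤⟨ *-monoʳ-≤ d (iterSize-bound s 2≤d u) ⟩
  d * (s * d ^ u)              ≡⟨ x*[y*z]≡y*[x*z] d s (d ^ u) ⟩
  s * (d * d ^ u)              ∎
  where
  open ≤-Reasoning
  s+s≤d*s : s + s ≤ d * s
  s+s≤d*s = subst (_≤ d * s) (cong (λ t → s + t) (+-identityʳ s)) (*-monoˡ-≤ s 2≤d)
  x*[y*z]≡y*[x*z] : ∀ x y z → x * (y * z) ≡ y * (x * z)
  x*[y*z]≡y*[x*z] = solve 3 (λ x y z → x :* (y :* z) := y :* (x :* z)) refl
    where open Data.Nat.Solver.+-*-Solver

u≤⌊log₂d^u⌋ : ∀ {d} → 2 ≤ d → ∀ u → u ≤ ⌊log₂ (d ^ u) ⌋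
u≤⌊log₂d^u⌋ {d} 2≤d u = subst (_≤ ⌊log₂ (d ^ u) ⌋) (⌊log₂[2^n]⌋≡n u) (⌊log₂⌋-mono-≤ (^-monoˡ-≤ u 2≤d))

LinearSizeLogDepth : ∀ {d} → (∀ u → Vec Bool (d ^ u) → Bool) → Set
LinearSizeLogDepth {d} g = Σ ℕ λ K → ∀ u → HasCircuit (g u) (K * d ^ u) (K * ⌊log₂ (d ^ u) ⌋ + K)

-- With d = 1 there is one input bit and log₂ n = 0, so the tree of depth u is replaced by a
-- single Shannon circuit.
gIter-circuits-unary : (f : Vec Bool 1 → Bool) → LinearSizeLogDepth (gIter f)
gIter-circuits-unary f = 6 , λ u → HasCircuit-mono
  (subst (λ N → shannonSize N ≤ 6 * N) (sym (^-zeroˡ u)) ≤-refl)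
  (subst (λ N → N * 3 ≤ 6 * ⌊log₂ N ⌋ + 6) (sym (^-zeroˡ u)) (m≤m+n 3 3))
  (circuit-of-gadget (shannon (1 ^ u) (gIter f u)))

gIter-circuits-2≤d : ∀ {d} (f : Vec Bool d → Bool) → 2 ≤ d → LinearSizeLogDepth (gIter f)
gIter-circuits-2≤d {d} f 2≤d = K , λ u →
  HasCircuit-mono (size≤ u) (depth≤ u) (circuit-of-gadget (gadget-gIter f u))
  where
  s = shannonSize d
  K = 16 + (s + s + d * 3)
  size≤ : ∀ u → let S = iterSize d s u in S + (S + 16) ≤ K * d ^ u
  size≤ u = begin
    S + (S + 16)              ≤⟨ +-mono-≤ S≤ (+-mono-≤ S≤ 16≤) ⟩
    s * N + (s * N + 16 * N)  ≡⟨ solve 3 (λ s N a → s :* N :+ (s :* N :+ a :* N) := (a :+ (s :+ s)) :* N)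
                                         refl s N 16 ⟩
    (16 + (s + s)) * N        ≤⟨ *-monoˡ-≤ N (+-monoʳ-≤ 16 (m≤m+n (s + s) (d * 3))) ⟩
    K * N                     ∎
    where
    open ≤-Reasoning
    open Data.Nat.Solver.+-*-Solver
    N = d ^ u
    S = iterSize d s u
    S≤ : S ≤ s * N
    S≤ = ≤-trans (m≤m+n S s) (iterSize-bound s 2≤d u)
    16≤ : 16 ≤ 16 * N
    16≤ = *-monoʳ-≤ 16 (subst (_≤ N) (^-zeroˡ u) (^-monoˡ-≤ u (≤-trans (s≤s z≤n) 2≤d)))
  depth≤ : ∀ u → 2 * 3 + u * (d * 3) ≤ K * ⌊log₂ (d ^ u) ⌋ + K
  depth≤ u = begin
    6 + u * (d * 3)  ≤⟨ +-mono-≤ (≤-trans (m≤m+n 6 10) (m≤m+n 16 _))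
                                 (*-mono-≤ (u≤⌊log₂d^u⌋ 2≤d u) (m≤n+m (d * 3) (16 + (s + s)))) ⟩
    K + L * K        ≡⟨ +-comm K (L * K) ⟩
    L * K + K        ≡⟨ cong (_+ K) (*-comm L K) ⟩
    K * L + K        ∎
    where
    open ≤-Reasoning
    L = ⌊log₂ (d ^ u) ⌋

gIter-circuits : ∀ {d} (f : Vec Bool d → Bool) → 0 < d → LinearSizeLogDepth (gIter f)
gIter-circuits {1}           f _ = gIter-circuits-unary f
gIter-circuits {suc (suc d)} f _ = gIter-circuits-2≤d f (s≤s (s≤s z≤n))

mainTheorem4 : (d p : ℕ) (f : Vec Bool d → Bool) → PDeg f p → p < d →
    ((u : ℕ) → 1 ≤ u → Resilient (gIter f u) (d ^ u ∸ p ^ u ∸ 1))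
    × Σ ℕ (λ K → (u : ℕ) → 1 ≤ u →
        Σ (Circuit (d ^ u)) (λ C → Computes C (gIter f u)
          × size C ≤ K * d ^ u
          × depth C ≤ K * ⌊log₂ (d ^ u) ⌋ + K))
mainTheorem4 d p f (c , represents , vanishes , _) p<d =
  resilient , Product.map₂ (λ circuits u _ → circuits u) (gIter-circuits f (≤-<-trans z≤n p<d))
  where
  resilient : ∀ u → 1 ≤ u → Resilient (gIter f u) (d ^ u ∸ p ^ u ∸ 1)
  resilient (suc u) _ = resilient-⊕parity {h = fIter f (suc u)}
    (degree≤-fIter {f = f} (c , represents , vanishes) (suc u)) (^-monoˡ-< (suc u) p<d)
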